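{- Let $G$ be a graph containing neither $K_3$ nor $C_4$ as an induced subgraph. Then $\chi_{FF}(G)\geq \log_2(\delta(G)+1)$.
   Context: All graphs are finite, simple and undirected. $\delta(G)$ denotes the minimum degree of $G$; $C_4$ is the cycle on 4 vertices. A Grundy $k$-coloring of $G$ is a proper coloring of the vertices with colors $\{1,\dots,k\}$ such that for any colors $i<j$, every vertex colored $j$ has a neighbor colored $i$. The First-Fit (Grundy) chromatic number $\chi_{FF}(G)$ is the largest $k$ for which $G$ admits a Grundy $k$-coloring (equivalently, the maximum number of colors used by First-Fit greedy coloring over all vertex orderings). Here $\log$ denotes the base-2 logarithm. -}

module Defs where

open import Data.Bool using (Bool; true; false; T; if_then_else_)
open import Data.Nat using (ℕ; zero; suc; _⊓_)
open import Data.Fin using (Fin; zero; suc; _<_)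
open import Data.List using (map; allFin)
open import Data.Nat.ListAction using (sum)
open import Data.Product using (Σ; ∃; _×_; _,_)
open import Relation.Binary.PropositionalEquality using (_≡_; _≢_)
open import Relation.Nullary using (¬_)
open import Function.Definitions using (Surjective)

record Graph : Set where
  field
    n      : ℕ
    adj    : Fin n → Fin n → Bool
    sym    : ∀ u v → adj u v ≡ adj v u
    irrefl : ∀ v → adj v v ≡ false

open Graph public

Adj : (G : Graph) → Fin (n G) → Fin (n G) → Set
Adj G u v = T (adj G u v)

degree : (G : Graph) → Fin (n G) → ℕ
degree G v = sum (map (λ u → if adj G v u then 1 else 0) (allFin (n G)))

minFin : ∀ m → (Fin (suc m) → ℕ) → ℕ
minFin zero    f = f zero
minFin (suc m) f = f zero ⊓ minFin m (λ i → f (suc i))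

-- minimum degree δ(G); convention δ = 0 for the graph with no vertices
δ : Graph → ℕ
δ G with n G | degree G
... | zero  | _ = 0
... | suc m | d = minFin m d

HasInducedK3 : Graph → Set
HasInducedK3 G = Σ (Fin (n G)) λ a → Σ (Fin (n G)) λ b → Σ (Fin (n G)) λ c →
  a ≢ b × b ≢ c × a ≢ c × Adj G a b × Adj G b c × Adj G a c

HasInducedC4 : Graph → Set
HasInducedC4 G = Σ (Fin (n G)) λ a → Σ (Fin (n G)) λ b →
  Σ (Fin (n G)) λ c → Σ (Fin (n G)) λ d →
  a ≢ b × a ≢ c × a ≢ d × b ≢ c × b ≢ d × c ≢ d ×
  Adj G a b × Adj G b c × Adj G c d × Adj G d a ×
  ¬ Adj G a c × ¬ Adj G b d

-- Grundy k-coloring, with colours Fin k = {0,…,k-1} standing for {1,…,k}: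
-- a proper colouring using all k colours such that every vertex of colour j
-- has a neighbour of every colour i < j.
record IsGrundyColoring (G : Graph) (k : ℕ) (c : Fin (n G) → Fin k) : Set where
  field
    proper : ∀ u v → Adj G u v → c u ≢ c v
    onto   : Surjective _≡_ _≡_ c
    grundy : ∀ v (i : Fin k) → i < c v → Σ (Fin (n G)) λ u → Adj G v u × c u ≡ i

HasGrundyColoring : Graph → ℕ → Set
HasGrundyColoring G k = Σ (Fin (n G) → Fin k) λ c → IsGrundyColoring G k c

-- Colour a vertex r with colour k by growing a binomial tree of order k at r:
-- r gets children x₀, …, x_{k-1}, each carrying a binomial tree of order j
-- rooted at x_j, and the tree is kept induced, so colouring every vertex by
-- its order is a partial Grundy colouring; First-Fit then extends it to all
-- of G. The tree has 2^k vertices. When a new child of p has to be chosen,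
-- every vertex y already used rules out at most one neighbour of p (the
-- neighbours of p in N[y]), since two of them would form a triangle or an
-- induced 4-cycle with p and y; so δ(G) + 1 ≥ 2^k suffices, and taking k
-- maximal gives 2^(k+1) ≥ δ(G) + 1 with at least k + 1 colours.
module Submission where

open import Defs hiding (sym)
open import Data.Bool using (Bool; true; false; T; if_then_else_)
open import Data.Empty using (⊥-elim)
open import Data.Fin using (Fin; zero; toℕ; fromℕ<) renaming (_≟_ to _≟ᶠ_)
open import Data.Fin.Properties using (toℕ-fromℕ<; toℕ-injective; toℕ<n)
open import Data.List using (List; []; _∷_; length; filter; map; allFin; _++_)
open import Data.List.Extrema.Nat using (max; xs≤max; argmax; f[xs]≤f[argmax])
open import Data.List.Membership.Propositional using (_∈_; _∉_)
open import Data.List.Membership.Propositional.Properties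
  using (∈-filter⁺; ∈-filter⁻; ∈-map⁺; ∈-map⁻; ∈-allFin; ∈-++⁺ʳ; ∈-++⁻)
import Data.List.Membership.DecPropositional as DecMembership
open import Data.List.Properties using (filter-all; length-++)
open import Data.List.Relation.Binary.Subset.Propositional using (_⊆_)
open import Data.List.Relation.Binary.Subset.Propositional.Properties
  using (∈-∷⁺ʳ; xs⊆x∷xs; xs⊆xs++ys; xs⊆ys++xs; ++⁺; ++⁺ˡ)
open import Data.List.Relation.Unary.All as All using ()
open import Data.List.Relation.Unary.AllPairs using (_∷_)
open import Data.List.Relation.Unary.Any using (here; there)
open import Data.List.Relation.Unary.Unique.Propositional using (Unique)
import Data.List.Relation.Unary.Unique.Propositional.Properties as Unique
open import Data.Nat using (ℕ; zero; suc; _+_; _*_; _^_; _≤_; _<_; z≤n; s≤s)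
import Data.Nat as ℕ
open import Data.Nat.ListAction using (sum)
open import Data.Nat.Properties
open import Data.Nat.Tactic.RingSolver using (solve-∀)
open import Data.Product using (Σ; ∃-syntax; _×_; _,_; proj₁; proj₂)
open import Data.Sum as Sum using (_⊎_; inj₁; inj₂; [_,_])
open import Data.Vec.Functional using (updateAt)
open import Data.Vec.Functional.Properties using (updateAt-updates; updateAt-minimal)
open import Function using (_∘_; const)
open import Level using (0ℓ)
open import Relation.Nullary using (¬_; yes; no; ¬?)
open import Relation.Nullary.Decidable using (T?)
open import Relation.Unary using (Pred; Decidable)
open import Relation.Binary.PropositionalEquality
  using (_≡_; _≢_; refl; sym; trans; cong; subst; module ≡-Reasoning)

module _ {A : Set} where

  AtMostOne : Pred A 0ℓ → List A → Set
  AtMostOne P xs = ∀ {a b} → a ∈ xs → b ∈ xs → P a → P b → a ≡ b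

  length≤1+length-filter-¬ : {P : Pred A 0ℓ} (P? : Decidable P) {xs : List A} →
    Unique xs → AtMostOne P xs → length xs ≤ suc (length (filter (¬? ∘ P?) xs))
  length≤1+length-filter-¬ P? {[]} _ _ = z≤n
  length≤1+length-filter-¬ P? {x ∷ xs} (x∉xs ∷ !xs) ≤1 with P? x
  ... | no _ = s≤s (length≤1+length-filter-¬ P? !xs (λ a∈ b∈ → ≤1 (there a∈) (there b∈)))
  ... | yes Px = ≤-reflexive (cong (suc ∘ length) (sym (filter-all (¬? ∘ P?) (All.tabulate ¬P))))
    where
    ¬P : ∀ {y} → y ∈ xs → ¬ _
    ¬P y∈ Py = All.lookup x∉xs y∈ (≤1 (here refl) (there y∈) Px Py)

  module _ {B : Set} (Blocks : B → Pred A 0ℓ) (Blocks? : ∀ b → Decidable (Blocks b)) where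

    ∃-unblocked : {xs : List A} → Unique xs → (bs : List B) →
      (∀ {b} → b ∈ bs → AtMostOne (Blocks b) xs) → length bs < length xs →
      ∃[ a ] (a ∈ xs × ∀ {b} → b ∈ bs → ¬ Blocks b a)
    ∃-unblocked {[]} _ [] _ ()
    ∃-unblocked {x ∷ _} _ [] _ _ = x , here refl , λ ()
    ∃-unblocked {xs} !xs (b ∷ bs) ≤1 |b∷bs|<|xs| =
      let (a , a∈xs′ , free) = ∃-unblocked (Unique.filter⁺ unblocked? !xs) bs ≤1′ |bs|<|xs′|
          (a∈xs , ¬Bba) = ∈-filter⁻ unblocked? a∈xs′
      in a , a∈xs , λ { (here refl) → ¬Bba ; (there b′∈) → free b′∈ }
      where
      unblocked? = ¬? ∘ Blocks? b
      ⊆xs : filter unblocked? xs ⊆ xs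
      ⊆xs = proj₁ ∘ ∈-filter⁻ unblocked?
      ≤1′ : ∀ {b′} → b′ ∈ bs → AtMostOne (Blocks b′) (filter unblocked? xs)
      ≤1′ b′∈ a∈ a′∈ = ≤1 (there b′∈) (⊆xs a∈) (⊆xs a′∈)
      |bs|<|xs′| : length bs < length (filter unblocked? xs)
      |bs|<|xs′| = ≤-pred (≤-trans |b∷bs|<|xs|
        (length≤1+length-filter-¬ (Blocks? b) !xs (≤1 (here refl))))

  sum-map-indicator≡length-filter : (b : A → Bool) (xs : List A) →
    sum (map (λ x → if b x then 1 else 0) xs) ≡ length (filter (T? ∘ b) xs)
  sum-map-indicator≡length-filter b [] = refl
  sum-map-indicator≡length-filter b (x ∷ xs) with b x
  ... | true  = cong suc (sum-map-indicator≡length-filter b xs)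
  ... | false = sum-map-indicator≡length-filter b xs

module _ where

  open DecMembership ℕ._≟_ using (_∈?_)

  all-below-∈⊎∃-mex : (xs : List ℕ) (n : ℕ) →
    (∀ {i} → i < n → i ∈ xs) ⊎ ∃[ m ] (m ∉ xs × ∀ {i} → i < m → i ∈ xs)
  all-below-∈⊎∃-mex xs zero = inj₁ λ ()
  all-below-∈⊎∃-mex xs (suc n) with all-below-∈⊎∃-mex xs n
  ... | inj₂ mex = inj₂ mex
  ... | inj₁ below with n ∈? xs
  ...   | no n∉ = inj₂ (n , n∉ , below)
  ...   | yes n∈ = inj₁ λ i<1+n → [ below , (λ { refl → n∈ }) ] (m<1+n⇒m<n∨m≡n i<1+n)

  mex : (xs : List ℕ) → ∃[ m ] (m ∉ xs × ∀ {i} → i < m → i ∈ xs)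
  mex xs with all-below-∈⊎∃-mex xs (suc (suc (max 0 xs)))
  ... | inj₂ mex = mex
  ... | inj₁ below = ⊥-elim (1+n≰n (All.lookup (xs≤max 0 xs) (below ≤-refl)))

binary-magnitude : ∀ n → ∃[ k ] (2 ^ k ≤ suc n × suc n ≤ 2 ^ suc k)
binary-magnitude zero = 0 , ≤-refl , s≤s z≤n
binary-magnitude (suc n) with binary-magnitude n
... | k , lo , hi with m≤n⇒m<n∨m≡n hi
...   | inj₁ 1+n<2^1+k = k , m≤n⇒m≤1+n lo , 1+n<2^1+k
...   | inj₂ 1+n≡2^1+k = suc k , m≤n⇒m≤1+n (≤-reflexive (sym 1+n≡2^1+k)) , doubled
  where
  open ≤-Reasoning
  x = 2 ^ suc k
  doubled : suc (suc n) ≤ 2 ^ suc (suc k)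
  doubled = begin
    suc (suc n)  ≡⟨ cong suc 1+n≡2^1+k ⟩
    suc x        ≡⟨ +-comm 1 x ⟩
    x + 1        ≤⟨ +-monoʳ-≤ x (m^n>0 2 (suc k)) ⟩
    x + x        ≡⟨ cong (x +_) (sym (+-identityʳ x)) ⟩
    2 * x        ∎

minFin≤ : ∀ m (f : Fin (suc m) → ℕ) i → minFin m f ≤ f i
minFin≤ zero    f zero    = ≤-refl
minFin≤ (suc m) f zero    = m⊓n≤m _ _
minFin≤ (suc m) f (Fin.suc i) = ≤-trans (m⊓n≤n _ _) (minFin≤ m (f ∘ Fin.suc) i)

δ≤degree : ∀ G v → δ G ≤ degree G v
δ≤degree G@(record { n = suc m }) v = minFin≤ m (degree G) v

module _ (G : Graph) where

  Adj-sym : ∀ {u v} → Adj G u v → Adj G v u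
  Adj-sym {u} {v} = subst T (Graph.sym G u v)

  Adj⇒≢ : ∀ {u v} → Adj G u v → u ≢ v
  Adj⇒≢ {u} uu refl = subst T (irrefl G u) uu

  Adj? : ∀ u → Decidable (Adj G u)
  Adj? u v = T? (adj G u v)

  neighbours : Fin (n G) → List (Fin (n G))
  neighbours u = filter (Adj? u) (allFin (n G))

  degree≡length-neighbours : ∀ u → degree G u ≡ length (neighbours u)
  degree≡length-neighbours u = sum-map-indicator≡length-filter (adj G u) (allFin (n G))

module Colourings (G : Graph) where

  V : Set
  V = Fin (n G)

  -- Colour 0 is the first colour; c is unconstrained off D.
  record IsPartialGrundy (D : List V) (c : V → ℕ) : Set where
    field
      proper : ∀ {u v} → u ∈ D → v ∈ D → Adj G u v → c u ≢ c v
      grundy : ∀ {u} → u ∈ D → ∀ {i} → i < c u → ∃[ v ] (v ∈ D × Adj G u v × c v ≡ i)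

  record PartialGrundy : Set where
    field
      dom             : List V
      col             : V → ℕ
      isPartialGrundy : IsPartialGrundy dom col
    open IsPartialGrundy isPartialGrundy public

  open PartialGrundy public

  ∅ : PartialGrundy
  ∅ = record { dom = [] ; col = const 0 ; isPartialGrundy = record { proper = λ () ; grundy = λ () } }

  record _⊑_ (γ γ′ : PartialGrundy) : Set where
    field
      keeps : ∀ {v} → v ∈ dom γ → v ∈ dom γ′ × col γ′ v ≡ col γ v

  open _⊑_ public

  ⊑-refl : ∀ {γ} → γ ⊑ γ
  keeps ⊑-refl v∈ = v∈ , refl

  ⊑-trans : ∀ {γ₁ γ₂ γ₃} → γ₁ ⊑ γ₂ → γ₂ ⊑ γ₃ → γ₁ ⊑ γ₃
  keeps (⊑-trans γ₁⊑γ₂ γ₂⊑γ₃) v∈ =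
    let (v∈₂ , c₂) = keeps γ₁⊑γ₂ v∈ ; (v∈₃ , c₃) = keeps γ₂⊑γ₃ v∈₂ in v∈₃ , trans c₃ c₂

  record Admissible (γ : PartialGrundy) (u : V) (m : ℕ) : Set where
    field
      fresh  : u ∉ dom γ
      avoids : ∀ {v} → v ∈ dom γ → Adj G u v → col γ v ≢ m
      sees   : ∀ {i} → i < m → ∃[ v ] (v ∈ dom γ × Adj G u v × col γ v ≡ i)

  module _ (γ : PartialGrundy) (u : V) (m : ℕ) (adm : Admissible γ u m) where

    open Admissible adm

    private
      c : V → ℕ
      c = updateAt (col γ) u (const m)

      c-u : c u ≡ m
      c-u = updateAt-updates u (col γ)

      c-dom : ∀ {v} → v ∈ dom γ → c v ≡ col γ v
      c-dom v∈ = updateAt-minimal _ u (col γ) λ { refl → fresh v∈ }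

      proper′ : ∀ {v w} → v ∈ u ∷ dom γ → w ∈ u ∷ dom γ → Adj G v w → c v ≢ c w
      proper′ (here refl) (here refl) vv     = ⊥-elim (Adj⇒≢ G vv refl)
      proper′ (here refl) (there w∈) uw e    =
        avoids w∈ uw (trans (sym (c-dom w∈)) (trans (sym e) c-u))
      proper′ (there v∈) (here refl) vu e    =
        avoids v∈ (Adj-sym G vu) (trans (sym (c-dom v∈)) (trans e c-u))
      proper′ (there v∈) (there w∈) vw e     =
        proper γ v∈ w∈ vw (trans (sym (c-dom v∈)) (trans e (c-dom w∈)))

      grundy′ : ∀ {v} → v ∈ u ∷ dom γ → ∀ {i} → i < c v → ∃[ w ] (w ∈ u ∷ dom γ × Adj G v w × c w ≡ i)
      grundy′ (here refl) i<c =
        let (w , w∈ , uw , cw) = sees (subst (_ <_) c-u i<c) in w , there w∈ , uw , trans (c-dom w∈) cw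
      grundy′ (there v∈) i<c =
        let (w , w∈ , vw , cw) = grundy γ v∈ (subst (_ <_) (c-dom v∈) i<c) in w , there w∈ , vw , trans (c-dom w∈) cw

    extend : PartialGrundy
    extend = record
      { dom = u ∷ dom γ ; col = c
      ; isPartialGrundy = record { proper = proper′ ; grundy = grundy′ } }

    ⊑-extend : γ ⊑ extend
    keeps ⊑-extend v∈ = there v∈ , c-dom v∈

    col-extend : col extend u ≡ m
    col-extend = c-u

  ∃-admissible : ∀ γ {u} → u ∉ dom γ → ∃[ m ] Admissible γ u m
  ∃-admissible γ {u} u∉ = m , record { fresh = u∉ ; avoids = avoids ; sees = sees }
    where
    coloured-neighbours = filter (Adj? G u) (dom γ)
    m = proj₁ (mex (map (col γ) coloured-neighbours))
    m∉ = proj₁ (proj₂ (mex (map (col γ) coloured-neighbours)))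
    below = proj₂ (proj₂ (mex (map (col γ) coloured-neighbours)))
    avoids : ∀ {v} → v ∈ dom γ → Adj G u v → col γ v ≢ m
    avoids v∈ uv cv≡m = m∉ (subst (_∈ map (col γ) coloured-neighbours) cv≡m (∈-map⁺ (col γ) (∈-filter⁺ (Adj? G u) v∈ uv)))
    sees : ∀ {i} → i < m → ∃[ v ] (v ∈ dom γ × Adj G u v × col γ v ≡ i)
    sees i<m =
      let (v , v∈ , i≡cv) = ∈-map⁻ (col γ) (below i<m)
          (v∈D , uv) = ∈-filter⁻ (Adj? G u) v∈
      in v , v∈D , uv , sym i≡cv

  open DecMembership (_≟ᶠ_ {n G}) using (_∈?_)

  firstFit : (L : List V) (γ : PartialGrundy) → ∃[ γ′ ] (γ ⊑ γ′ × L ⊆ dom γ′)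
  firstFit [] γ = γ , ⊑-refl , λ ()
  firstFit (u ∷ L) γ with u ∈? dom γ
  ... | yes u∈ =
    let (γ′ , γ⊑γ′ , L⊆) = firstFit L γ in γ′ , γ⊑γ′ , ∈-∷⁺ʳ (proj₁ (keeps γ⊑γ′ u∈)) L⊆
  ... | no u∉ =
    let (m , adm) = ∃-admissible γ u∉
        (γ′ , γ⁺⊑γ′ , L⊆) = firstFit L (extend γ u m adm)
    in γ′ , ⊑-trans (⊑-extend γ u m adm) γ⁺⊑γ′ , ∈-∷⁺ʳ (proj₁ (keeps γ⁺⊑γ′ (here refl))) L⊆

  total⇒HasGrundyColoring : (γ : PartialGrundy) → (∀ v → v ∈ dom γ) → (r : V) →
    ∃[ K ] (HasGrundyColoring G K × col γ r < K)
  total⇒HasGrundyColoring γ total r =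
    suc (col γ w) , (c , record { proper = proper′ ; onto = onto ; grundy = grundy′ }) , s≤s (≤max r)
    where
    w = argmax (col γ) r (allFin (n G))
    ≤max : ∀ v → col γ v ≤ col γ w
    ≤max v = All.lookup (f[xs]≤f[argmax] {f = col γ} r (allFin (n G))) (∈-allFin v)
    c : V → Fin (suc (col γ w))
    c v = fromℕ< (s≤s (≤max v))
    toℕ-c : ∀ v → toℕ (c v) ≡ col γ v
    toℕ-c v = toℕ-fromℕ< (s≤s (≤max v))
    c≡ : ∀ {v i} → col γ v ≡ toℕ i → c v ≡ i
    c≡ {v} e = toℕ-injective (trans (toℕ-c v) e)
    proper′ : ∀ u v → Adj G u v → c u ≢ c v
    proper′ u v uv e = proper γ (total u) (total v) uv
      (trans (sym (toℕ-c u)) (trans (cong toℕ e) (toℕ-c v)))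
    onto : ∀ i → ∃[ v ] (∀ {z} → z ≡ v → c z ≡ i)
    onto i with m<1+n⇒m<n∨m≡n (toℕ<n i)
    ... | inj₂ i≡max = w , λ { refl → c≡ (sym i≡max) }
    ... | inj₁ i<max =
      let (v , _ , _ , cv) = grundy γ (total w) i<max in v , λ { refl → c≡ cv }
    grundy′ : ∀ v i → toℕ i < toℕ (c v) → ∃[ u ] (Adj G v u × c u ≡ i)
    grundy′ v i i<cv =
      let (u , _ , vu , cu) = grundy γ (total v) (subst (_ <_) (toℕ-c v) i<cv) in u , vu , c≡ cu

module InducedK3C4Free (G : Graph) (noK3 : ¬ HasInducedK3 G) (noC4 : ¬ HasInducedC4 G) where

  open Colourings G

  _∈N[_] : V → V → Set
  a ∈N[ y ] = a ≡ y ⊎ Adj G a y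

  ∈N? : ∀ y → Decidable (_∈N[ y ])
  ∈N? y a with a ≟ᶠ y | Adj? G a y
  ... | yes a≡y | _      = yes (inj₁ a≡y)
  ... | no _    | yes ay = yes (inj₂ ay)
  ... | no a≢y  | no ¬ay = no [ a≢y , ¬ay ]

  _∉N[_] : V → List V → Set
  x ∉N[ Y ] = ∀ {y} → y ∈ Y → ¬ x ∈N[ y ]

  ∉N[]-⊆ : ∀ {x Y Y′} → Y ⊆ Y′ → x ∉N[ Y′ ] → x ∉N[ Y ]
  ∉N[]-⊆ Y⊆Y′ x∉N y∈ = x∉N (Y⊆Y′ y∈)

  ∉N[]⇒∉ : ∀ {x Y} → x ∉N[ Y ] → x ∉ Y
  ∉N[]⇒∉ x∉N x∈ = x∉N x∈ (inj₁ refl)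

  ∈N-neighbour-unique : ∀ {p y a b} → p ≢ y → Adj G p a → Adj G p b → a ∈N[ y ] → b ∈N[ y ] → a ≡ b
  ∈N-neighbour-unique _ _ _ (inj₁ refl) (inj₁ refl) = refl
  ∈N-neighbour-unique {p} {y} {a} {b} p≢y pa pb (inj₁ refl) (inj₂ by) =
    ⊥-elim (noK3 (p , a , b , p≢y , Adj⇒≢ G (Adj-sym G by) , Adj⇒≢ G pb , pa , Adj-sym G by , pb))
  ∈N-neighbour-unique {p} {y} {a} {b} p≢y pa pb (inj₂ ay) (inj₁ refl) =
    ⊥-elim (noK3 (p , b , a , p≢y , Adj⇒≢ G (Adj-sym G ay) , Adj⇒≢ G pa , pb , Adj-sym G ay , pa))
  ∈N-neighbour-unique {p} {y} {a} {b} p≢y pa pb (inj₂ ay) (inj₂ by) with a ≟ᶠ b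
  ... | yes a≡b = a≡b
  ... | no a≢b = ⊥-elim (noC4 (p , a , y , b ,
        Adj⇒≢ G pa , p≢y , Adj⇒≢ G pb , Adj⇒≢ G ay , a≢b , Adj⇒≢ G (Adj-sym G by) ,
        pa , ay , Adj-sym G by , Adj-sym G pb , ¬py , ¬ab))
    where
    ¬py : ¬ Adj G p y
    ¬py py = noK3 (p , a , y , Adj⇒≢ G pa , Adj⇒≢ G ay , p≢y , pa , ay , py)
    ¬ab : ¬ Adj G a b
    ¬ab ab = noK3 (p , a , b , Adj⇒≢ G pa , a≢b , Adj⇒≢ G pb , pa , ab , pb)

  ∃-neighbour-∉N : ∀ p (Y : List V) → p ∉ Y → length Y < degree G p → ∃[ x ] (Adj G p x × x ∉N[ Y ])
  ∃-neighbour-∉N p Y p∉Y |Y|<deg =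
    let (x , x∈ , x∉N) = ∃-unblocked (λ y → _∈N[ y ]) ∈N? !neighbours Y ≤1 |Y|<|neighbours|
    in x , neighbour x∈ , x∉N
    where
    !neighbours : Unique (neighbours G p)
    !neighbours = Unique.filter⁺ (Adj? G p) (Unique.allFin⁺ (n G))
    neighbour : ∀ {a} → a ∈ neighbours G p → Adj G p a
    neighbour = proj₂ ∘ ∈-filter⁻ (Adj? G p) {xs = allFin (n G)}
    ≤1 : ∀ {y} → y ∈ Y → AtMostOne (_∈N[ y ]) (neighbours G p)
    ≤1 y∈ a∈ b∈ = ∈N-neighbour-unique (λ { refl → p∉Y y∈ }) (neighbour a∈) (neighbour b∈)
    |Y|<|neighbours| : length Y < length (neighbours G p)
    |Y|<|neighbours| = subst (length Y <_) (degree≡length-neighbours G p) |Y|<deg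

  -- A lists the ancestors of the root p that are still waiting for their colour.
  record Tree (k : ℕ) (p : V) (A : List V) (γ : PartialGrundy) : Set where
    field
      γ⁺     : PartialGrundy
      γ⊑γ⁺   : γ ⊑ γ⁺
      p∈     : p ∈ dom γ⁺
      col-p  : col γ⁺ p ≡ k
      size   : length (dom γ⁺) ≡ length (dom γ) + 2 ^ k
      new    : ∀ {v} → v ∈ dom γ⁺ → v ∈ dom γ ⊎ v ≡ p ⊎ v ∉N[ dom γ ++ A ]

  -- The subtrees of orders 0, …, j - 1 below the still uncoloured root p.
  record Branches (j : ℕ) (p : V) (A : List V) (γ : PartialGrundy) : Set where
    field
      γ⁺     : PartialGrundy
      γ⊑γ⁺   : γ ⊑ γ⁺
      p∉     : p ∉ dom γ⁺
      below  : ∀ {v} → v ∈ dom γ⁺ → Adj G p v → col γ⁺ v < j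
      sees   : ∀ {i} → i < j → ∃[ v ] (v ∈ dom γ⁺ × Adj G p v × col γ⁺ v ≡ i)
      size   : suc (length (dom γ⁺)) ≡ length (dom γ) + 2 ^ j
      new    : ∀ {v} → v ∈ dom γ⁺ → v ∈ dom γ ⊎ v ∉N[ dom γ ++ A ]

  plant : ∀ {k p A γ} → Branches k p A γ → Tree k p A γ
  plant {k} {p} B = record
    { γ⁺ = extend B.γ⁺ p k adm
    ; γ⊑γ⁺ = ⊑-trans B.γ⊑γ⁺ (⊑-extend B.γ⁺ p k adm)
    ; p∈ = here refl
    ; col-p = col-extend B.γ⁺ p k adm
    ; size = B.size
    ; new = λ { (here refl) → inj₂ (inj₁ refl) ; (there v∈) → Sum.map₂ inj₂ (B.new v∈) }
    }
    where
    module B = Branches B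
    adm : Admissible B.γ⁺ p k
    adm = record { fresh = B.p∉ ; avoids = λ v∈ pv → <⇒≢ (B.below v∈ pv) ; sees = B.sees }

  graft : ∀ {j p x A γ} (B : Branches j p A γ) → Adj G p x → x ∉N[ dom (Branches.γ⁺ B) ++ A ] →
    Tree j x (p ∷ A) (Branches.γ⁺ B) → Branches (suc j) p A γ
  graft {j} {p} {x} {A} {γ} B px x∉N T = record
    { γ⁺ = T.γ⁺ ; γ⊑γ⁺ = ⊑-trans B.γ⊑γ⁺ T.γ⊑γ⁺
    ; p∉ = p∉ ; below = below ; sees = sees ; size = size ; new = new }
    where
    module B = Branches B
    module T = Tree T
    open ≡-Reasoning

    p∉ : p ∉ dom T.γ⁺
    p∉ p∈ with T.new p∈
    ... | inj₁ p∈B          = B.p∉ p∈B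
    ... | inj₂ (inj₁ p≡x)   = Adj⇒≢ G px p≡x
    ... | inj₂ (inj₂ p∉N)   = p∉N (∈-++⁺ʳ (dom B.γ⁺) (here refl)) (inj₁ refl)

    below : ∀ {v} → v ∈ dom T.γ⁺ → Adj G p v → col T.γ⁺ v < suc j
    below v∈ pv with T.new v∈
    ... | inj₁ v∈B          = subst (_< suc j) (sym (proj₂ (keeps T.γ⊑γ⁺ v∈B))) (m<n⇒m<1+n (B.below v∈B pv))
    ... | inj₂ (inj₁ refl)  = subst (_< suc j) (sym T.col-p) ≤-refl
    ... | inj₂ (inj₂ v∉N)   = ⊥-elim (v∉N (∈-++⁺ʳ (dom B.γ⁺) (here refl)) (inj₂ (Adj-sym G pv)))

    sees : ∀ {i} → i < suc j → ∃[ v ] (v ∈ dom T.γ⁺ × Adj G p v × col T.γ⁺ v ≡ i)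
    sees i<1+j with m<1+n⇒m<n∨m≡n i<1+j
    ... | inj₂ refl = x , T.p∈ , px , T.col-p
    ... | inj₁ i<j  =
      let (v , v∈ , pv , cv) = B.sees i<j ; (v∈T , cTv) = keeps T.γ⊑γ⁺ v∈ in v , v∈T , pv , trans cTv cv

    size : suc (length (dom T.γ⁺)) ≡ length (dom γ) + 2 ^ suc j
    size = begin
      suc (length (dom T.γ⁺))                  ≡⟨ cong suc T.size ⟩
      suc (length (dom B.γ⁺)) + 2 ^ j          ≡⟨ cong (_+ 2 ^ j) B.size ⟩
      length (dom γ) + 2 ^ j + 2 ^ j           ≡⟨ doubling (length (dom γ)) (2 ^ j) ⟩
      length (dom γ) + 2 * 2 ^ j               ∎
      where
      doubling : ∀ a b → a + b + b ≡ a + 2 * b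
      doubling = solve-∀

    dom⊆ : dom γ ⊆ dom B.γ⁺
    dom⊆ = proj₁ ∘ keeps B.γ⊑γ⁺

    new : ∀ {v} → v ∈ dom T.γ⁺ → v ∈ dom γ ⊎ v ∉N[ dom γ ++ A ]
    new v∈ with T.new v∈
    ... | inj₁ v∈B          = B.new v∈B
    ... | inj₂ (inj₁ refl)  = inj₂ (∉N[]-⊆ (++⁺ˡ A dom⊆) x∉N)
    ... | inj₂ (inj₂ v∉N)   = inj₂ (∉N[]-⊆ (++⁺ dom⊆ (xs⊆x∷xs A p)) v∉N)

  -- The tree adds 2^k vertices, and each vertex of dom γ, of A or of the tree
  -- rules out at most one neighbour of the current parent (∈N-neighbour-unique),
  -- so a free one remains among its δ(G) or more neighbours.
  Room : ℕ → List V → PartialGrundy → Set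
  Room k A γ = length (dom γ) + length A + 2 ^ k ≤ suc (δ G)

  mutual
    tree : ∀ k {p A γ} → p ∉N[ dom γ ] → p ∉ A → Room k A γ → Tree k p A γ
    tree k p∉N p∉A room = plant (branches k p∉N p∉A room)

    branches : ∀ j {p A γ} → p ∉N[ dom γ ] → p ∉ A → Room j A γ → Branches j p A γ
    branches zero {γ = γ} p∉N _ _ = record
      { γ⁺ = γ ; γ⊑γ⁺ = ⊑-refl ; p∉ = ∉N[]⇒∉ p∉N
      ; below = λ v∈ pv → ⊥-elim (p∉N v∈ (inj₂ pv)) ; sees = λ ()
      ; size = +-comm 1 (length (dom γ)) ; new = inj₁ }
    branches (suc j) {p} {A} {γ} p∉N p∉A room =
      graft B px x∉N (tree j (∉N[]-⊆ (xs⊆xs++ys _ A) x∉N) x∉p∷A room′)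
      where
      B = branches j p∉N p∉A (≤-trans (+-monoʳ-≤ _ (^-monoʳ-≤ 2 (n≤1+n j))) room)
      module B = Branches B
      open ≤-Reasoning

      slack : length (dom B.γ⁺) + length A + 2 ^ j ≤ δ G
      slack = ≤-pred (begin
        suc (length (dom B.γ⁺)) + length A + 2 ^ j       ≡⟨ cong (λ s → s + length A + 2 ^ j) B.size ⟩
        length (dom γ) + 2 ^ j + length A + 2 ^ j        ≡⟨ regroup (length (dom γ)) (length A) (2 ^ j) ⟩
        length (dom γ) + length A + 2 * 2 ^ j            ≤⟨ room ⟩
        suc (δ G)                                        ∎)
        where
        regroup : ∀ a b c → a + c + b + c ≡ a + b + 2 * c
        regroup = solve-∀

      |Y|<deg : length (dom B.γ⁺ ++ A) < degree G p
      |Y|<deg = begin-strict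
        length (dom B.γ⁺ ++ A)                 ≡⟨ length-++ (dom B.γ⁺) ⟩
        length (dom B.γ⁺) + length A           <⟨ m<m+n _ (m^n>0 2 j) ⟩
        length (dom B.γ⁺) + length A + 2 ^ j   ≤⟨ slack ⟩
        δ G                                    ≤⟨ δ≤degree G p ⟩
        degree G p                             ∎

      p∉Y : p ∉ dom B.γ⁺ ++ A
      p∉Y = [ B.p∉ , p∉A ] ∘ ∈-++⁻ (dom B.γ⁺)

      picked = ∃-neighbour-∉N p (dom B.γ⁺ ++ A) p∉Y |Y|<deg
      x = proj₁ picked
      px = proj₁ (proj₂ picked)
      x∉N = proj₂ (proj₂ picked)

      x∉p∷A : x ∉ p ∷ A
      x∉p∷A (here x≡p) = Adj⇒≢ G px (sym x≡p)
      x∉p∷A (there x∈A) = ∉N[]⇒∉ (∉N[]-⊆ (xs⊆ys++xs A _) x∉N) x∈A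

      room′ : Room j (p ∷ A) B.γ⁺
      room′ = subst (_≤ suc (δ G)) (cong (_+ 2 ^ j) (sym (+-suc _ (length A)))) (s≤s slack)

open Colourings using (∅; firstFit; total⇒HasGrundyColoring; keeps)

corollary1 : (G : Graph) → ¬ HasInducedK3 G → ¬ HasInducedC4 G →
    Σ ℕ λ k → HasGrundyColoring G k × suc (δ G) ≤ 2 ^ k
corollary1 G@(record { n = zero }) _ _ =
  0 , ((λ ()) , record { proper = λ () ; onto = λ () ; grundy = λ () }) , s≤s z≤n
corollary1 G@(record { n = suc _ }) noK3 noC4 =
  let (k , 2^k≤1+δ , 1+δ≤2^1+k) = binary-magnitude (δ G)
      rooted = tree k {zero} {[]} {∅ G} (λ ()) (λ ()) 2^k≤1+δ
      (γ , rooted⊑γ , all⊆γ) = firstFit G (allFin _) (Tree.γ⁺ rooted)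
      (K , grundyK , col-r<K) = total⇒HasGrundyColoring G γ (all⊆γ ∘ ∈-allFin) zero
      k<K = subst (_< K) (trans (proj₂ (keeps rooted⊑γ (Tree.p∈ rooted))) (Tree.col-p rooted)) col-r<K
  in K , grundyK , ≤-trans 1+δ≤2^1+k (^-monoʳ-≤ 2 k<K)
  where open InducedK3C4Free G noK3 noC4
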